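{- For each $n\ge0$ and $e\in\mathbf{I}_n(\underline{10}1)$, assign the label $L(e)=(a,b)=(|A_{\ge}(e)|,|B_{<}(e)|)$. Then the empty sequence has label $(1,0)$, and if $e\in\mathbf{I}_n(\underline{10}1)$ has label $(a,b)$, then the multiset of labels $\{L(eh): h \text{ an active site of } e\}$ equals the multiset consisting of $(a+2-i,\,b-1+i)$ for $i=1,\dots,a$ together with $(a+b+1-i,\,i-1)$ for $i=1,\dots,b$; that is, $(a+1,b),(a,b+1),\dots,(2,b+a-1),(a+b,0),(a+b-1,1),\dots,(a+1,b-1)$.
   Context: $\mathbf{I}_n$ is the set of integer sequences $e_1\dots e_n$ with $0\le e_i<i$; $\mathbf{I}_n(\underline{10}1)$ is the set of $e\in\mathbf{I}_n$ with no positions $i$, $k$ with $i+1<k$ and $e_i=e_k>e_{i+1}$. For $e\in\mathbf{I}_n(\underline{10}1)$, an active site is a value $h\in\{0,\dots,n\}$ with $eh=e_1\dots e_nh\in\mathbf{I}_{n+1}(\underline{10}1)$. With the convention $e_0=0$ (used when $n=0$), $A_{\ge}(e)$ is the set of active sites $h$ with $h\ge e_n$ and $B_{<}(e)$ the set of active sites $h$ with $h<e_n$. -}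

module Defs where

open import Data.Nat using (ℕ; zero; suc; _+_; _∸_; _<ᵇ_; _≤ᵇ_; _≡ᵇ_)
open import Data.Bool using (Bool; true; false; _∧_; not)
open import Data.List using (List; []; _∷_; _++_; [_]; upTo; map; filter; length)
open import Data.Bool.ListAction using (all; any)
open import Data.Product using (_×_; _,_)
open import Relation.Nullary.Decidable using (Dec; yes; no)
open import Data.Bool.Properties using (T?)

-- Sequences e = e₁ … eₙ are lists [e₁, …, eₙ].
-- at e i = e_{i+1} (0-based index), with default 0 out of range.
at : List ℕ → ℕ → ℕ
at []       _       = 0
at (x ∷ _)  zero    = x
at (_ ∷ xs) (suc i) = at xs i

-- e ∈ Iₙ : 0 ≤ e_i < i for every (1-based) position i.
isInv : List ℕ → Bool
isInv e = all (λ i → at e i <ᵇ suc i) (upTo (length e))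

-- occurrence of the pattern 10-underline-1: 1-based positions i, k with
-- i + 1 < k and e_i = e_k > e_{i+1}  (here stated with 0-based indices).
hasPattern : List ℕ → Bool
hasPattern e =
  any (λ i → any (λ k → (suc i <ᵇ k) ∧ ((at e i ≡ᵇ at e k) ∧ (at e (suc i) <ᵇ at e i)))
                 (upTo (length e)))
      (upTo (length e))

inI101 : List ℕ → Bool
inI101 e = isInv e ∧ not (hasPattern e)

isActive : List ℕ → ℕ → Bool
isActive e h = inI101 (e ++ [ h ])

activeSites : List ℕ → List ℕ
activeSites e = filter (λ h → T? (isActive e h)) (upTo (suc (length e)))

-- last entry e_n, with the convention e_0 = 0 for the empty sequence
lastE : List ℕ → ℕ
lastE []           = 0
lastE (x ∷ [])     = x
lastE (_ ∷ y ∷ ys) = lastE (y ∷ ys)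

Age : List ℕ → List ℕ
Age e = filter (λ h → T? (lastE e ≤ᵇ h)) (activeSites e)

Blt : List ℕ → List ℕ
Blt e = filter (λ h → T? (h <ᵇ lastE e)) (activeSites e)

label : List ℕ → ℕ × ℕ
label e = length (Age e) , length (Blt e)

childLabels : List ℕ → List (ℕ × ℕ)
childLabels e = map (λ h → label (e ++ [ h ])) (activeSites e)

oneTo : ℕ → List ℕ
oneTo m = map suc (upTo m)

ruleChildren : ℕ × ℕ → List (ℕ × ℕ)
ruleChildren (a , b) =
  map (λ i → (a + 2 ∸ i , b + i ∸ 1)) (oneTo a)
  ++ map (λ i → (a + b + 1 ∸ i , i ∸ 1)) (oneTo b)

-- Write S for the active sites of e and ℓ = e_n; then L(e) = rank S ℓ, where
-- rank S t = (#{x ∈ S | x ≥ t}, #{x ∈ S | x < t}).  The proof has three parts.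
--  • Sorted lists (general): on a strictly increasing S the entry of index j has rank
--    (|S| - j, j).  Splitting S at ℓ into the entries B < ℓ and A ≥ ℓ, any labelling giving
--    x ≥ ℓ the label rank S x + (1, 0) and x < ℓ the label rank S x produces exactly the two
--    halves of the rule (`succession-rule`).
--  • Active sites: reading the Boolean definitions as propositions, a value h ≤ n is active iff
--    it is not blocked, i.e. not the top e_i > e_{i+1} of a descent with i+1 < n.  Appending an
--    active h blocks, in addition, exactly ℓ when h < ℓ; the values n+1 and ℓ are always active.
--  • Hence the sites of e h are S ++ [n+1] if h ≥ ℓ and S ∖ {ℓ} ++ [n+1] if h < ℓ, so the
--    children's labels are rank S h + (1, 0), resp. rank S h, and the succession rule applies.
module Submission where

open import Defs
open import Data.Nat using (ℕ; zero; suc; _+_; _∸_; _<ᵇ_; _≤ᵇ_; _<_; _≤_; z≤n; s≤s; s≤s⁻¹; z<s; s<s)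
open import Data.Nat.Properties
open import Data.Bool using (Bool; true; false; not; T)
open import Data.Bool.Properties using (T?; T-∧)
open import Data.Bool.ListAction using (all; any)
open import Data.Sum using (_⊎_; inj₁; inj₂; [_,_]′)
open import Data.Product using (_×_; _,_; proj₁; proj₂; map₂; ∃-syntax; ∃₂)
open import Data.List using (List; []; _∷_; _++_; [_]; upTo; filter; length; map; applyUpTo)
open import Data.List.Properties
  using (filter-++; filter-accept; filter-reject; filter-all; filter-none; filter-≐; length-++; upTo-∷ʳ;
         map-∘; map-++; map-cong-local; map-upTo; map-applyUpTo)
open import Data.List.Membership.Propositional using (_∈_)
open import Data.List.Membership.Propositional.Properties using (∈-filter⁺; ∈-filter⁻; ∈-upTo⁺; ∈-upTo⁻)
open import Data.List.Relation.Binary.Permutation.Propositional using (_↭_; ↭-reflexive; ↭-trans)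
open import Data.List.Relation.Binary.Permutation.Propositional.Properties using (++-comm)
open import Data.List.Relation.Unary.All using (All; []; _∷_)
import Data.List.Relation.Unary.All as All
import Data.List.Relation.Unary.All.Properties as Allₚ
open import Data.List.Relation.Unary.Any using (here; there)
open import Data.List.Relation.Unary.Any.Properties using (any⇔)
import Data.List.Relation.Unary.Any.Properties as Anyₚ
open import Data.List.Relation.Unary.AllPairs using (AllPairs; []; _∷_)
import Data.List.Relation.Unary.AllPairs as AllPairs
import Data.List.Relation.Unary.AllPairs.Properties as AllPairsₚ
open import Data.List.Relation.Unary.Unique.Propositional using (Unique)
open import Function using (_∘_; _⇔_; mk⇔; Equivalence)
open import Relation.Nullary using (¬_; contradiction; Dec; yes; no; ¬?; does; _×-dec_)
open import Relation.Unary using (Decidable)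
open import Relation.Binary.PropositionalEquality
  using (_≡_; refl; sym; trans; cong; cong₂; subst; subst₂; module ≡-Reasoning)

open Equivalence using (to; from)
open ≡-Reasoning

T-not : ∀ {b} → T (not b) ⇔ (¬ T b)
T-not {true}  = mk⇔ (λ ()) (λ ¬t → ¬t _)
T-not {false} = mk⇔ (λ _ ()) _

T-any-upTo : ∀ {p : ℕ → Bool} {n} → T (any p (upTo n)) ⇔ (∃[ i ] (i < n × T (p i)))
T-any-upTo = mk⇔
  (λ t → Anyₚ.applyUpTo⁻ (λ i → i) (from any⇔ t))
  (λ (i , i<n , pi) → to any⇔ (Anyₚ.applyUpTo⁺ (λ i → i) pi i<n))

T-all-upTo : ∀ {p : ℕ → Bool} {n} → T (all p (upTo n)) ⇔ (∀ i → i < n → T (p i))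
T-all-upTo {p} {n} = mk⇔
  (λ t i → Allₚ.applyUpTo⁻ (λ i → i) n (Allₚ.all⁺ p (upTo n) t))
  (λ f → Allₚ.all⁻ p (Allₚ.applyUpTo⁺₁ (λ i → i) n (f _)))

length-filter-++ : ∀ {P : ℕ → Set} (P? : Decidable P) xs ys →
                   length (filter P? (xs ++ ys)) ≡ length (filter P? xs) + length (filter P? ys)
length-filter-++ P? xs ys = trans (cong length (filter-++ P? xs ys)) (length-++ (filter P? xs))

filter-refine : ∀ {R P Q : ℕ → Set} (R? : Decidable R) (P? : Decidable P) (Q? : Decidable Q) {xs} →
                All (λ x → R x ⇔ (P x × Q x)) xs → filter R? xs ≡ filter Q? (filter P? xs)
filter-refine R? P? Q? [] = refl
filter-refine R? P? Q? {x ∷ xs} (r ∷ rs) with R? x | P? x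
... | yes Rx | yes Px = trans (cong (x ∷_) (filter-refine R? P? Q? rs)) (sym (filter-accept Q? (proj₂ (to r Rx))))
... | yes Rx | no ¬Px = contradiction (proj₁ (to r Rx)) ¬Px
... | no ¬Rx | yes Px = trans (filter-refine R? P? Q? rs) (sym (filter-reject Q? (λ Qx → ¬Rx (from r (Px , Qx)))))
... | no ¬Rx | no ¬Px = filter-refine R? P? Q? rs

without : ℕ → List ℕ → List ℕ
without y = filter (λ x → ¬? (x ≟ y))

length-filter-without : ∀ {P : ℕ → Set} (P? : Decidable P) {y xs} → Unique xs → y ∈ xs → P y →
                        suc (length (filter P? (without y xs))) ≡ length (filter P? xs)
length-filter-without P? {y} {y ∷ xs} (y∉xs ∷ _) (here refl) Py = begin
  suc (length (filter P? (without y (y ∷ xs))))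
    ≡⟨ cong (suc ∘ length ∘ filter P?) (filter-reject (λ z → ¬? (z ≟ y)) λ y≢y → y≢y refl) ⟩
  suc (length (filter P? (without y xs)))
    ≡⟨ cong (suc ∘ length ∘ filter P?) (filter-all (λ z → ¬? (z ≟ y)) (All.map (_∘ sym) y∉xs)) ⟩
  suc (length (filter P? xs))
    ≡⟨ cong length (filter-accept P? Py) ⟨
  length (filter P? (y ∷ xs)) ∎
length-filter-without P? {y} {x ∷ xs} (x∉xs ∷ u) (there y∈xs) Py =
  trans (cong (suc ∘ length ∘ filter P?) (filter-accept (λ z → ¬? (z ≟ y)) (All.lookup x∉xs y∈xs)))
        (same-head (length-filter-without P? u y∈xs Py))
  where
  same-head : ∀ {as} → suc (length (filter P? as)) ≡ length (filter P? xs) →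
         suc (length (filter P? (x ∷ as))) ≡ length (filter P? (x ∷ xs))
  same-head eq with does (P? x)
  ... | true  = cong suc eq
  ... | false = eq

filter-without : ∀ {P : ℕ → Set} (P? : Decidable P) {y} xs → ¬ P y → filter P? (without y xs) ≡ filter P? xs
filter-without P? [] _ = refl
filter-without P? {y} (x ∷ xs) ¬Py with x ≟ y
... | yes refl = trans (cong (filter P?) (filter-reject (λ z → ¬? (z ≟ y)) λ y≢y → y≢y refl))
                       (trans (filter-without P? xs ¬Py) (sym (filter-reject P? ¬Py)))
... | no  x≢y  = trans (cong (filter P?) (filter-accept (λ z → ¬? (z ≟ y)) x≢y))
                       (same-head (filter-without P? xs ¬Py))
  where
  same-head : ∀ {as} → filter P? as ≡ filter P? xs → filter P? (x ∷ as) ≡ filter P? (x ∷ xs)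
  same-head eq with does (P? x)
  ... | true  = cong (x ∷_) eq
  ... | false = eq

applyUpTo-cong : ∀ {A : Set} {f g : ℕ → A} m → (∀ {j} → j < m → f j ≡ g j) →
                 applyUpTo f m ≡ applyUpTo g m
applyUpTo-cong zero    _   = refl
applyUpTo-cong (suc m) f≡g = cong₂ _∷_ (f≡g z<s) (applyUpTo-cong m (f≡g ∘ s<s))

atLeast? : ∀ t → Decidable (λ x → T (t ≤ᵇ x))
atLeast? t x = T? (t ≤ᵇ x)

below? : ∀ t → Decidable (λ x → T (x <ᵇ t))
below? t x = T? (x <ᵇ t)

atLeast below : ℕ → List ℕ → List ℕ
atLeast t = filter (atLeast? t)
below   t = filter (below? t)

-- rank xs t = (#entries ≥ t , #entries < t); `label e` is literally rank (activeSites e) (lastE e).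
rank : List ℕ → ℕ → ℕ × ℕ
rank xs t = length (atLeast t xs) , length (below t xs)

_⊕_ : ℕ × ℕ → ℕ × ℕ → ℕ × ℕ
(a , b) ⊕ (c , d) = a + c , b + d

rank-++ : ∀ xs ys t → rank (xs ++ ys) t ≡ rank xs t ⊕ rank ys t
rank-++ xs ys t = cong₂ _,_ (length-filter-++ (atLeast? t) xs ys) (length-filter-++ (below? t) xs ys)

rank-all-below : ∀ {t ys} → All (_< t) ys → rank ys t ≡ (0 , length ys)
rank-all-below {t} ys<t =
  cong₂ _,_ (cong length (filter-none (atLeast? t) (All.map (λ y<t → <⇒≱ y<t ∘ ≤ᵇ⇒≤ _ _) ys<t)))
            (cong length (filter-all (below? t) (All.map <⇒<ᵇ ys<t)))

rank-all-above : ∀ {t ys} → All (t <_) ys → rank ys t ≡ (length ys , 0)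
rank-all-above {t} t<ys =
  cong₂ _,_ (cong length (filter-all (atLeast? t) (All.map (≤⇒≤ᵇ ∘ <⇒≤) t<ys)))
            (cong length (filter-none (below? t) (All.map (λ t<y → <⇒≯ t<y ∘ <ᵇ⇒< _ _) t<ys)))

rank-self : ∀ t → rank [ t ] t ≡ (1 , 0)
rank-self t = cong₂ _,_ (cong length (filter-accept (atLeast? t) (≤⇒≤ᵇ (≤-refl {t}))))
                        (cong length (filter-reject (below? t) (<-irrefl refl ∘ <ᵇ⇒< t t)))

ranks : ∀ {xs} → AllPairs _<_ xs → map (rank xs) xs ≡ applyUpTo (λ j → length xs ∸ j , j) (length xs)
ranks [] = refl
ranks {x ∷ xs} (x<xs ∷ sorted) = cong₂ _∷_ first rest
  where
  first : rank (x ∷ xs) x ≡ (suc (length xs) , 0)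
  first = trans (rank-++ [ x ] xs x) (cong₂ _⊕_ (rank-self x) (rank-all-above x<xs))
  later : ∀ {y} → x < y → rank (x ∷ xs) y ≡ map₂ suc (rank xs y)
  later {y} x<y = trans (rank-++ [ x ] xs y) (cong (_⊕ rank xs y) (rank-all-below (x<y ∷ [])))
  rest : map (rank (x ∷ xs)) xs ≡ applyUpTo (λ j → length xs ∸ j , suc j) (length xs)
  rest = begin
    map (rank (x ∷ xs)) xs                    ≡⟨ map-cong-local (All.map later x<xs) ⟩
    map (map₂ suc ∘ rank xs) xs               ≡⟨ map-∘ xs ⟩
    map (map₂ suc) (map (rank xs) xs)         ≡⟨ cong (map (map₂ suc)) (ranks sorted) ⟩
    map (map₂ suc) (applyUpTo (λ j → length xs ∸ j , j) (length xs))
                                              ≡⟨ map-applyUpTo _ (map₂ suc) (length xs) ⟩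
    applyUpTo (λ j → length xs ∸ j , suc j) (length xs) ∎

labels-by-rank : ∀ {xs} (L : ℕ → ℕ × ℕ) (f : ℕ × ℕ → ℕ × ℕ) → AllPairs _<_ xs →
  (∀ {x} → x ∈ xs → L x ≡ f (rank xs x)) →
  map L xs ≡ applyUpTo (λ j → f (length xs ∸ j , j)) (length xs)
labels-by-rank {xs} L f sorted L≡f = begin
  map L xs                                                ≡⟨ map-cong-local (All.tabulate L≡f) ⟩
  map (f ∘ rank xs) xs                                    ≡⟨ map-∘ xs ⟩
  map f (map (rank xs) xs)                                ≡⟨ cong (map f) (ranks sorted) ⟩
  map f (applyUpTo (λ j → length xs ∸ j , j) (length xs)) ≡⟨ map-applyUpTo _ f (length xs) ⟩
  applyUpTo (λ j → f (length xs ∸ j , j)) (length xs)     ∎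

-- The two halves of the succession rule, re-indexed from j = i - 1 = 0.
-- (The summands + 1 and + 0 are those produced by _⊕_ in `succession-rule`.)
rule-above : ∀ a b →
  map (λ i → a + 2 ∸ i , b + i ∸ 1) (oneTo a) ≡ applyUpTo (λ j → a ∸ j + 1 , b + j + 0) a
rule-above a b = trans (sym (map-∘ (upTo a))) (trans (map-upTo _ a) (applyUpTo-cong a pointwise))
  where
  pointwise : ∀ {j} → j < a → (a + 2 ∸ suc j , b + suc j ∸ 1) ≡ (a ∸ j + 1 , b + j + 0)
  pointwise {j} j<a = cong₂ _,_ (trans (cong (_∸ suc j) (+-suc a 1)) (+-∸-comm 1 (<⇒≤ j<a)))
                                (trans (cong (_∸ 1) (+-suc b j)) (sym (+-identityʳ _)))

rule-below : ∀ a b →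
  map (λ i → a + b + 1 ∸ i , i ∸ 1) (oneTo b) ≡ applyUpTo (λ j → b ∸ j + a , j + 0) b
rule-below a b = trans (sym (map-∘ (upTo b))) (trans (map-upTo _ b) (applyUpTo-cong b pointwise))
  where
  pointwise : ∀ {j} → j < b → (a + b + 1 ∸ suc j , j) ≡ (b ∸ j + a , j + 0)
  pointwise {j} j<b = cong₂ _,_ (trans (cong (_∸ suc j) (+-comm (a + b) 1))
                                       (trans (+-∸-assoc a (<⇒≤ j<b)) (+-comm a (b ∸ j))))
                                (sym (+-identityʳ j))

sorted-split : ∀ ℓ {xs} → AllPairs _<_ xs → below ℓ xs ++ atLeast ℓ xs ≡ xs
sorted-split ℓ [] = refl
sorted-split ℓ {x ∷ xs} (x<xs ∷ sorted) with x <? ℓ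
... | yes x<ℓ = trans (cong₂ _++_ (filter-accept (below? ℓ) (<⇒<ᵇ x<ℓ))
                                 (filter-reject (atLeast? ℓ) (<⇒≱ x<ℓ ∘ ≤ᵇ⇒≤ _ _)))
                      (cong (x ∷_) (sorted-split ℓ sorted))
... | no  x≮ℓ = cong₂ _++_ (filter-none (below? ℓ) (All.map (λ ℓ≤y → ≤⇒≯ ℓ≤y ∘ <ᵇ⇒< _ _) ℓ≤x∷xs))
                           (filter-all (atLeast? ℓ) (All.map ≤⇒≤ᵇ ℓ≤x∷xs))
  where
  ℓ≤x = ≮⇒≥ x≮ℓ
  ℓ≤x∷xs : All (ℓ ≤_) (x ∷ xs)
  ℓ≤x∷xs = ℓ≤x ∷ All.map (λ x<y → ≤-trans ℓ≤x (<⇒≤ x<y)) x<xs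

succession-rule : ∀ ℓ {S} (L : ℕ → ℕ × ℕ) → AllPairs _<_ S →
  (∀ {x} → x ∈ S → ℓ ≤ x → L x ≡ rank S x ⊕ (1 , 0)) →
  (∀ {x} → x ∈ S → x < ℓ → L x ≡ rank S x) →
  map L S ↭ ruleChildren (rank S ℓ)
succession-rule ℓ {S} L sorted L-above L-below =
  ↭-trans (↭-reflexive (trans (cong (map L) (sym split)) (map-++ L B A)))
          (↭-trans (++-comm (map L B) (map L A)) (↭-reflexive (cong₂ _++_ labels-A labels-B)))
  where
  B = below ℓ S
  A = atLeast ℓ S
  split = sorted-split ℓ sorted
  rank-S : ∀ x → rank S x ≡ rank B x ⊕ rank A x
  rank-S x = trans (cong (λ xs → rank xs x) (sym split)) (rank-++ B A x)
  labels-A : map L A ≡ map (λ i → length A + 2 ∸ i , length B + i ∸ 1) (oneTo (length A))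
  labels-A = trans (labels-by-rank L (λ r → ((0 , length B) ⊕ r) ⊕ (1 , 0)) (AllPairsₚ.filter⁺ (atLeast? ℓ) sorted) on-A)
                   (sym (rule-above (length A) (length B)))
    where
    B-below : ∀ {x} → ℓ ≤ x → All (_< x) B
    B-below ℓ≤x = All.tabulate λ {y} y∈B →
      <-≤-trans (<ᵇ⇒< y ℓ (proj₂ (∈-filter⁻ (below? ℓ) {xs = S} y∈B))) ℓ≤x
    on-A : ∀ {x} → x ∈ A → L x ≡ ((0 , length B) ⊕ rank A x) ⊕ (1 , 0)
    on-A {x} x∈A with x∈S , ℓ≤x ← ∈-filter⁻ (atLeast? ℓ) {xs = S} x∈A =
      trans (L-above x∈S (≤ᵇ⇒≤ ℓ x ℓ≤x))
            (cong (_⊕ (1 , 0)) (trans (rank-S x)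
                                      (cong (_⊕ rank A x) (rank-all-below (B-below (≤ᵇ⇒≤ ℓ x ℓ≤x))))))
  labels-B : map L B ≡ map (λ i → length A + length B + 1 ∸ i , i ∸ 1) (oneTo (length B))
  labels-B = trans (labels-by-rank L (_⊕ (length A , 0)) (AllPairsₚ.filter⁺ (below? ℓ) sorted) on-B)
                   (sym (rule-below (length A) (length B)))
    where
    A-above : ∀ {x} → x < ℓ → All (x <_) A
    A-above x<ℓ = All.tabulate λ {y} y∈A →
      <-≤-trans x<ℓ (≤ᵇ⇒≤ ℓ y (proj₂ (∈-filter⁻ (atLeast? ℓ) {xs = S} y∈A)))
    on-B : ∀ {x} → x ∈ B → L x ≡ rank B x ⊕ (length A , 0)
    on-B {x} x∈B with x∈S , x<ℓ ← ∈-filter⁻ (below? ℓ) {xs = S} x∈B =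
      trans (L-below x∈S (<ᵇ⇒< x ℓ x<ℓ))
            (trans (rank-S x) (cong (rank B x ⊕_) (rank-all-above (A-above (<ᵇ⇒< x ℓ x<ℓ)))))

IsInversion : List ℕ → Set
IsInversion e = ∀ i → i < length e → at e i ≤ i

isInv⇔ : ∀ e → T (isInv e) ⇔ IsInversion e
isInv⇔ e = mk⇔ (λ t i i<n → s≤s⁻¹ (<ᵇ⇒< _ _ (to T-all-upTo t i i<n)))
             (λ inv → from T-all-upTo (λ i i<n → <⇒<ᵇ (s≤s (inv i i<n))))

Occurrence : List ℕ → ℕ → ℕ → Set
Occurrence e i k = suc i < k × k < length e × at e i ≡ at e k × at e (suc i) < at e i

hasPattern⇔ : ∀ e → T (hasPattern e) ⇔ ∃₂ (Occurrence e)
hasPattern⇔ e = mk⇔ found found⁻¹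
  where
  found : T (hasPattern e) → ∃₂ (Occurrence e)
  found t with i , _ , t′ ← to (T-any-upTo {n = length e}) t
          with k , k<n , q ← to (T-any-upTo {n = length e}) t′
          with si<k , q′ ← to T-∧ q
          with eq , lt ← to T-∧ q′
    = i , k , <ᵇ⇒< _ _ si<k , k<n , ≡ᵇ⇒≡ _ _ eq , <ᵇ⇒< _ _ lt
  found⁻¹ : ∃₂ (Occurrence e) → T (hasPattern e)
  found⁻¹ (i , k , si<k , k<n , eq , lt) =
    from T-any-upTo (i , <-trans (n<1+n i) (<-trans si<k k<n) ,
      from T-any-upTo (k , k<n , from T-∧ (<⇒<ᵇ si<k , from T-∧ (≡⇒≡ᵇ _ _ eq , <⇒<ᵇ lt))))

inI101⇔ : ∀ e → T (inI101 e) ⇔ (IsInversion e × ¬ ∃₂ (Occurrence e))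
inI101⇔ e = mk⇔
  (λ t → let inv , noOcc = to (T-∧ {isInv e}) t
         in to (isInv⇔ e) inv , λ occ → to T-not noOcc (from (hasPattern⇔ e) occ))
  (λ (inv , noOcc) → from T-∧ (from (isInv⇔ e) inv , from T-not (noOcc ∘ to (hasPattern⇔ e))))

at-++ˡ : ∀ e {f i} → i < length e → at (e ++ f) i ≡ at e i
at-++ˡ (y ∷ e) {i = zero}  _         = refl
at-++ˡ (y ∷ e) {i = suc i} (s≤s i<n) = at-++ˡ e i<n

at-++-length : ∀ e {x f} → at (e ++ x ∷ f) (length e) ≡ x
at-++-length []      = refl
at-++-length (y ∷ e) = at-++-length e

length-snoc : ∀ e {x : ℕ} → length (e ++ [ x ]) ≡ suc (length e)
length-snoc []      = refl
length-snoc (y ∷ e) = cong suc (length-snoc e)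

<-length-snoc : ∀ e {x i} → i ≤ length e → i < length (e ++ [ x ])
<-length-snoc e i≤n = subst (_ <_) (sym (length-snoc e)) (s≤s i≤n)

<-length-snoc⁻ : ∀ e {x i} → i < length (e ++ [ x ]) → i ≤ length e
<-length-snoc⁻ e i<n′ = s≤s⁻¹ (subst (_ <_) (length-snoc e) i<n′)

lastE-snoc : ∀ e {x} → lastE (e ++ [ x ]) ≡ x
lastE-snoc []          = refl
lastE-snoc (y ∷ [])    = refl
lastE-snoc (y ∷ z ∷ e) = lastE-snoc (z ∷ e)

lastE-at : ∀ e {i} → suc i ≡ length e → at e i ≡ lastE e
lastE-at (y ∷ [])    {zero}  refl = refl
lastE-at (y ∷ z ∷ e) {suc i} eq   = lastE-at (z ∷ e) (suc-injective eq)

inversion-snoc : ∀ e {x} → IsInversion (e ++ [ x ]) ⇔ (IsInversion e × x ≤ length e)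
inversion-snoc e {x} = mk⇔
  (λ inv′ → (λ i i<n → subst (_≤ i) (at-++ˡ e i<n) (inv′ i (<-length-snoc e (<⇒≤ i<n))))
          , subst (_≤ length e) (at-++-length e) (inv′ (length e) (<-length-snoc e ≤-refl)))
  (λ (inv , x≤n) i i<n′ → extend inv x≤n i (m≤n⇒m<n∨m≡n (<-length-snoc⁻ e i<n′)))
  where
  extend : IsInversion e → x ≤ length e → ∀ i → i < length e ⊎ i ≡ length e → at (e ++ [ x ]) i ≤ i
  extend inv _   i (inj₁ i<n) = subst (_≤ i) (sym (at-++ˡ e i<n)) (inv i i<n)
  extend _   x≤n _ (inj₂ refl) = subst (_≤ length e) (sym (at-++-length e)) x≤n

-- x is blocked in e when it is the top e_i > e_{i+1} of a descent that is not at the end (i+1 < n):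
-- exactly the values whose appending would create an occurrence of 10̲1.
Blocked : List ℕ → ℕ → Set
Blocked e x = ∃[ i ] (suc i < length e × at e i ≡ x × at e (suc i) < x)

occurrences-snoc : ∀ e {x} → ∃₂ (Occurrence (e ++ [ x ])) ⇔ (∃₂ (Occurrence e) ⊎ Blocked e x)
occurrences-snoc e {x} = mk⇔ split merge
  where
  same : ∀ {j} → j < length e → at (e ++ [ x ]) j ≡ at e j
  same = at-++ˡ e
  split : ∃₂ (Occurrence (e ++ [ x ])) → ∃₂ (Occurrence e) ⊎ Blocked e x
  split (i , k , si<k , k<n′ , eq , lt) with m≤n⇒m<n∨m≡n (<-length-snoc⁻ e k<n′)
  ... | inj₁ k<n  = inj₁ (i , k , si<k , k<n , trans (sym (same i<n)) (trans eq (same k<n))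
                         , subst₂ _<_ (same si<n) (same i<n) lt)
    where si<n = <-trans si<k k<n
          i<n  = <-trans (n<1+n i) si<n
  ... | inj₂ refl = inj₂ (i , si<k , trans (sym (same i<n)) eq′ , subst₂ _<_ (same si<k) eq′ lt)
    where i<n = <-trans (n<1+n i) si<k
          eq′ = trans eq (at-++-length e)
  merge : ∃₂ (Occurrence e) ⊎ Blocked e x → ∃₂ (Occurrence (e ++ [ x ]))
  merge (inj₁ (i , k , si<k , k<n , eq , lt)) =
    i , k , si<k , <-length-snoc e (<⇒≤ k<n) , trans (same i<n) (trans eq (sym (same k<n)))
      , subst₂ _<_ (sym (same si<n)) (sym (same i<n)) lt
    where si<n = <-trans si<k k<n
          i<n  = <-trans (n<1+n i) si<n
  merge (inj₂ (i , si<n , eq , lt)) =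
    i , length e , si<n , <-length-snoc e ≤-refl , trans (same i<n) (trans eq (sym (at-++-length e)))
      , subst₂ _<_ (sym (same si<n)) (sym (trans (same i<n) eq)) lt
    where i<n = <-trans (n<1+n i) si<n

-- Appending h blocks, in addition, the old last entry when h descends from it.
Excluded : List ℕ → ℕ → ℕ → Set
Excluded e h x = x ≡ lastE e × h < lastE e

-- The descent e_n > h created by appending h sits at the (new) non-final position n-1.
last-blocked : ∀ e {h} → h < lastE e → Blocked (e ++ [ h ]) (lastE e)
last-blocked (y ∷ e) h<ℓ =
  length e , <-length-snoc (y ∷ e) ≤-refl
  , trans (at-++ˡ (y ∷ e) ≤-refl) (lastE-at (y ∷ e) refl)
  , subst (_< lastE (y ∷ e)) (sym (at-++-length (y ∷ e))) h<ℓ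

blocked-snoc : ∀ e {h x} → Blocked (e ++ [ h ]) x ⇔ (Blocked e x ⊎ Excluded e h x)
blocked-snoc e {h} {x} = mk⇔ split merge
  where
  same : ∀ {j} → j < length e → at (e ++ [ h ]) j ≡ at e j
  same = at-++ˡ e
  split : Blocked (e ++ [ h ]) x → Blocked e x ⊎ Excluded e h x
  split (i , si<n′ , eq , lt) with m≤n⇒m<n∨m≡n (<-length-snoc⁻ e si<n′)
  ... | inj₁ si<n = inj₁ (i , si<n , trans (sym (same (<-trans (n<1+n i) si<n))) eq
                         , subst (_< x) (same si<n) lt)
  ... | inj₂ si≡n = inj₂ (x≡ℓ , subst₂ _<_ h′≡h x≡ℓ lt)
    where x≡ℓ  = trans (sym eq) (trans (same (subst (i <_) si≡n (n<1+n i))) (lastE-at e si≡n))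
          h′≡h = trans (cong (at (e ++ [ h ])) si≡n) (at-++-length e)
  merge : Blocked e x ⊎ Excluded e h x → Blocked (e ++ [ h ]) x
  merge (inj₁ (i , si<n , eq , lt)) =
    i , <-length-snoc e (<⇒≤ si<n) , trans (same (<-trans (n<1+n i) si<n)) eq
      , subst (_< x) (sym (same si<n)) lt
  merge (inj₂ (refl , h<ℓ)) = last-blocked e h<ℓ

-- In a pattern-free e the last entry is not blocked: the descent would either end at
-- position n, or form an occurrence of 10̲1 with the last entry.
final-not-blocked : ∀ e → ¬ ∃₂ (Occurrence e) → ¬ Blocked e (lastE e)
final-not-blocked (y ∷ e) noOcc (i , si<n , eq , lt) with m≤n⇒m<n∨m≡n (s≤s⁻¹ si<n)
... | inj₁ si<m = noOcc (i , length e , si<m , ≤-refl , trans eq (sym (lastE-at (y ∷ e) refl)) , lt′)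
  where lt′ = subst (at (y ∷ e) (suc i) <_) (sym eq) lt
... | inj₂ si≡m = <-irrefl (lastE-at (y ∷ e) (cong suc si≡m)) lt

-- Blocked values are entries e_i with i < n, so they lie below n.
blocked-bound : ∀ e {x} → IsInversion e → Blocked e x → x < length e
blocked-bound e inv (i , si<n , refl , _) = ≤-<-trans (inv i i<n) i<n
  where i<n = <-trans (n<1+n i) si<n

lastE-bound : ∀ e → IsInversion e → lastE e ≤ length e
lastE-bound []      _   = z≤n
lastE-bound (y ∷ e) inv =
  subst (_≤ suc (length e)) (lastE-at (y ∷ e) refl) (m≤n⇒m≤1+n (inv (length e) ≤-refl))

active⇔ : ∀ e {x} → T (inI101 e) → T (isActive e x) ⇔ (x ≤ length e × ¬ Blocked e x)
active⇔ e {x} e∈I = mk⇔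
  (λ act → let inv′ , noOcc′ = to (inI101⇔ (e ++ [ x ])) act
           in proj₂ (to (inversion-snoc e) inv′) , λ b → noOcc′ (from (occurrences-snoc e) (inj₂ b)))
  (λ (x≤n , ¬b) → from (inI101⇔ (e ++ [ x ]))
     (from (inversion-snoc e) (inv , x≤n) , [ noOcc , ¬b ]′ ∘ to (occurrences-snoc e)))
  where
  inv   = proj₁ (to (inI101⇔ e) e∈I)
  noOcc = proj₂ (to (inI101⇔ e) e∈I)

-- The largest value n is always active, since blocked values are below n.
top-active : ∀ e → T (inI101 e) → T (isActive e (length e))
top-active e e∈I =
  from (active⇔ e e∈I) (≤-refl , λ b → <-irrefl refl (blocked-bound e (proj₁ (to (inI101⇔ e) e∈I)) b))

final-active : ∀ e → T (inI101 e) → T (isActive e (lastE e))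
final-active e e∈I = from (active⇔ e e∈I) (lastE-bound e inv , final-not-blocked e noOcc)
  where
  inv   = proj₁ (to (inI101⇔ e) e∈I)
  noOcc = proj₂ (to (inI101⇔ e) e∈I)

child-active⇔ : ∀ e {h x} → T (inI101 e) → T (isActive e h) → x ≤ length e →
                T (isActive (e ++ [ h ]) x) ⇔ (T (isActive e x) × ¬ Excluded e h x)
child-active⇔ e {h} {x} e∈I eh∈I x≤n = mk⇔
  (λ act → let _ , ¬b′ = to (active⇔ (e ++ [ h ]) eh∈I) act
           in from (active⇔ e e∈I) (x≤n , ¬b′ ∘ from (blocked-snoc e {h}) ∘ inj₁)
            , ¬b′ ∘ from (blocked-snoc e {h}) ∘ inj₂)
  (λ (act , ¬ex) → from (active⇔ (e ++ [ h ]) eh∈I)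
     (x≤n′ , [ proj₂ (to (active⇔ e e∈I) act) , ¬ex ]′ ∘ to (blocked-snoc e {h})))
  where
  x≤n′ = subst (x ≤_) (sym (length-snoc e)) (m≤n⇒m≤1+n x≤n)

excluded? : ∀ e h x → Dec (Excluded e h x)
excluded? e h x = (x ≟ lastE e) ×-dec (h <? lastE e)

activeSites-sorted : ∀ e → AllPairs _<_ (activeSites e)
activeSites-sorted e = AllPairsₚ.filter⁺ (λ x → T? (isActive e x))
                                         (AllPairsₚ.applyUpTo⁺₁ (λ i → i) (suc (length e)) (λ i<j _ → i<j))

activeSites-child : ∀ e {h} → T (inI101 e) → T (isActive e h) →
  activeSites (e ++ [ h ]) ≡ filter (¬? ∘ excluded? e h) (activeSites e) ++ [ suc (length e) ]
activeSites-child e {h} e∈I eh∈I = begin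
  filter active′? (upTo (suc (length (e ++ [ h ]))))
    ≡⟨ cong (filter active′? ∘ upTo ∘ suc) (length-snoc e) ⟩
  filter active′? (upTo (suc (suc n)))
    ≡⟨ cong (filter active′?) (upTo-∷ʳ (suc n)) ⟨
  filter active′? (upTo (suc n) ++ [ suc n ])
    ≡⟨ filter-++ active′? (upTo (suc n)) [ suc n ] ⟩
  filter active′? (upTo (suc n)) ++ filter active′? [ suc n ]
    ≡⟨ cong₂ _++_ (filter-refine active′? active? (¬? ∘ excluded? e h) old-sites)
                  (filter-accept active′? top) ⟩
  filter (¬? ∘ excluded? e h) (activeSites e) ++ [ suc n ] ∎
  where
  n = length e
  active? = λ x → T? (isActive e x)
  active′? = λ x → T? (isActive (e ++ [ h ]) x)
  old-sites = All.map (λ x<n+1 → child-active⇔ e e∈I eh∈I (s≤s⁻¹ x<n+1)) (Allₚ.all-upTo (suc n))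
  top = subst (T ∘ isActive (e ++ [ h ])) (length-snoc e) (top-active (e ++ [ h ]) eh∈I)

active-site : ∀ e {h} → h ∈ activeSites e → T (isActive e h) × h ≤ length e
active-site e h∈S
  with h∈upTo , act ← ∈-filter⁻ (λ x → T? (isActive e x)) {xs = upTo (suc (length e))} h∈S
  = act , s≤s⁻¹ (∈-upTo⁻ h∈upTo)

label-child : ∀ e {h} → T (inI101 e) → T (isActive e h) → h ≤ length e →
  label (e ++ [ h ]) ≡ rank (filter (¬? ∘ excluded? e h) (activeSites e)) h ⊕ (1 , 0)
label-child e {h} e∈I eh∈I h≤n = begin
  rank (activeSites (e ++ [ h ])) (lastE (e ++ [ h ]))
    ≡⟨ cong₂ rank (activeSites-child e e∈I eh∈I) (lastE-snoc e) ⟩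
  rank (F ++ [ suc (length e) ]) h
    ≡⟨ rank-++ F [ suc (length e) ] h ⟩
  rank F h ⊕ rank [ suc (length e) ] h
    ≡⟨ cong (rank F h ⊕_) (rank-all-above (s≤s h≤n ∷ [])) ⟩
  rank F h ⊕ (1 , 0) ∎
  where
  F = filter (¬? ∘ excluded? e h) (activeSites e)

-- If h ≥ e_n nothing is excluded: the child gains the new site n + 1 above h.
label-child-≥ : ∀ e {h} → T (inI101 e) → T (isActive e h) → h ≤ length e → lastE e ≤ h →
  label (e ++ [ h ]) ≡ rank (activeSites e) h ⊕ (1 , 0)
label-child-≥ e {h} e∈I eh∈I h≤n ℓ≤h =
  trans (label-child e e∈I eh∈I h≤n) (cong (λ xs → rank xs h ⊕ (1 , 0)) nothing-excluded)
  where
  nothing-excluded : filter (¬? ∘ excluded? e h) (activeSites e) ≡ activeSites e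
  nothing-excluded = filter-all (¬? ∘ excluded? e h) (All.universal (λ _ (_ , h<ℓ) → ≤⇒≯ ℓ≤h h<ℓ) _)

-- If h < e_n the site e_n ≥ h is lost and n + 1 is gained: the counts are unchanged.
label-child-< : ∀ e {h} → T (inI101 e) → T (isActive e h) → h ≤ length e → h < lastE e →
  label (e ++ [ h ]) ≡ rank (activeSites e) h
label-child-< e {h} e∈I eh∈I h≤n h<ℓ = begin
  label (e ++ [ h ])                              ≡⟨ label-child e e∈I eh∈I h≤n ⟩
  rank (filter (¬? ∘ excluded? e h) S) h ⊕ (1 , 0) ≡⟨ cong (λ xs → rank xs h ⊕ (1 , 0)) only-ℓ-excluded ⟩
  rank (without ℓ S) h ⊕ (1 , 0)                  ≡⟨ cong₂ _,_ loses-ℓ keeps-below ⟩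
  rank S h                                        ∎
  where
  ℓ = lastE e
  S = activeSites e
  only-ℓ-excluded : filter (¬? ∘ excluded? e h) S ≡ without ℓ S
  only-ℓ-excluded = filter-≐ (¬? ∘ excluded? e h) (λ x → ¬? (x ≟ ℓ))
                      ((λ ¬ex x≡ℓ → ¬ex (x≡ℓ , h<ℓ)) , (λ x≢ℓ (x≡ℓ , _) → x≢ℓ x≡ℓ)) S
  S-unique : Unique S
  S-unique = AllPairs.map <⇒≢ (activeSites-sorted e)
  -- ℓ is an active site occurring once in S; removing it loses one site ≥ h and none < h.
  ℓ∈S : ℓ ∈ S
  ℓ∈S = ∈-filter⁺ (λ x → T? (isActive e x))
                  (∈-upTo⁺ (s≤s (lastE-bound e (proj₁ (to (inI101⇔ e) e∈I))))) (final-active e e∈I)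
  loses-ℓ : length (atLeast h (without ℓ S)) + 1 ≡ length (atLeast h S)
  loses-ℓ = trans (+-comm _ 1) (length-filter-without (atLeast? h) S-unique ℓ∈S (≤⇒≤ᵇ (<⇒≤ h<ℓ)))
  keeps-below : length (below h (without ℓ S)) + 0 ≡ length (below h S)
  keeps-below = trans (+-identityʳ _) (cong length (filter-without (below? h) S (<⇒≯ h<ℓ ∘ <ᵇ⇒< _ _)))

proposition3p10 :
    (label [] ≡ (1 , 0))
    × ((e : List ℕ) → T (inI101 e) → childLabels e ↭ ruleChildren (label e))
proposition3p10 = refl , children
  where
  children : (e : List ℕ) → T (inI101 e) → childLabels e ↭ ruleChildren (label e)
  children e e∈I = succession-rule (lastE e) (λ h → label (e ++ [ h ])) (activeSites-sorted e)
    (λ h∈S ℓ≤h → let act , h≤n = active-site e h∈S in label-child-≥ e e∈I act h≤n ℓ≤h)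
    (λ h∈S h<ℓ → let act , h≤n = active-site e h∈S in label-child-< e e∈I act h≤n h<ℓ)
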